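{- Let $g,h,k\in\mathbb{N}$ with $h,k\geq 2$ and $g\leq\min\{h,k\}$. Let $M\subseteq[h]\times[k]$ be a matching of size $g$ (i.e. $g$ pairs, no two sharing a first coordinate or a second coordinate). For disjoint sets $X=\{x_1,\ldots,x_h\}$ and $Y=\{y_1,\ldots,y_k\}$ let $\mathbf{C}_{ -g}(h,k)$ be the poset on $X\cup Y$ whose strict relations are exactly $x_i\prec y_j$ for all $(i,j)\in([h]\times[k])\setminus M$. Then $\dim(\mathbf{C}_{ -g}(h,k))=\max\{2,g\}$.
   Context: The order dimension $\dim(\mathbf{Q})$ of a finite poset $\mathbf{Q}=(X,\preceq)$ is the least number $d$ of linear extensions $\preceq_1,\ldots,\preceq_d$ of $\preceq$ such that for all $x,y\in X$: $x\preceq y$ iff $x\preceq_i y$ for all $i\in[d]$. $[n]=\{1,\ldots,n\}$. -}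

module Defs where

open import Level using (0ℓ)
open import Data.Nat using (ℕ)
open import Data.Fin using (Fin)
open import Data.Sum using (_⊎_; inj₁; inj₂)
open import Data.Product using (Σ; _×_; proj₁; proj₂; _,_)
open import Data.List using (List; length; map)
open import Data.List.Membership.Propositional using (_∈_)
open import Data.List.Relation.Unary.Unique.Propositional using (Unique)
open import Relation.Binary.Core using (Rel)
open import Relation.Binary.Structures using (IsPartialOrder; IsTotalOrder)
open import Relation.Binary.PropositionalEquality using (_≡_)
open import Relation.Nullary using (¬_)

record Poset : Set₁ where
  field
    Carrier : Set
    _≼_     : Rel Carrier 0ℓ
    isPartialOrder : IsPartialOrder _≡_ _≼_

record LinearExtension (P : Poset) : Set₁ where
  open Poset P
  field
    _≤L_        : Rel Carrier 0ℓ
    isTotalOrder : IsTotalOrder _≡_ _≤L_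
    extends      : ∀ x y → x ≼ y → x ≤L y

Realizer : Poset → ℕ → Set₁
Realizer P d =
  Σ (Fin d → LinearExtension P) λ L →
    ∀ x y → (∀ i → LinearExtension._≤L_ (L i) x y) → Poset._≼_ P x y

HasDimension : Poset → ℕ → Set₁
HasDimension P d = Realizer P d × (∀ d' → d' Data.Nat.< d → ¬ Realizer P d')

record Matching (g h k : ℕ) : Set where
  field
    pairs    : List (Fin h × Fin k)
    size     : length pairs ≡ g
    uniqueFst : Unique (map proj₁ pairs)
    uniqueSnd : Unique (map proj₂ pairs)

data CRel {g h k : ℕ} (M : Matching g h k) : Rel (Fin h ⊎ Fin k) 0ℓ where
  c-refl : ∀ {z} → CRel M z z
  c-lt   : ∀ {i j} → ¬ ((i , j) ∈ Matching.pairs M) → CRel M (inj₁ i) (inj₂ j)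

private
  open import Relation.Binary.PropositionalEquality using (refl; isEquivalence)

  CRel-trans : ∀ {g h k} (M : Matching g h k) {a b c} → CRel M a b → CRel M b c → CRel M a c
  CRel-trans M c-refl q = q
  CRel-trans M (c-lt x) c-refl = c-lt x

  CRel-antisym : ∀ {g h k} (M : Matching g h k) {a b} → CRel M a b → CRel M b a → a ≡ b
  CRel-antisym M c-refl _ = refl

CRel-isPartialOrder : ∀ {g h k} (M : Matching g h k) → IsPartialOrder _≡_ (CRel M)
CRel-isPartialOrder M = record
  { isPreorder = record
    { isEquivalence = isEquivalence
    ; reflexive = λ { refl → c-refl }
    ; trans = CRel-trans M }
  ; antisym = CRel-antisym M }

C-g : ∀ {g h k} → Matching g h k → Poset
C-g {h = h} {k} M = record
  { Carrier = Fin h ⊎ Fin k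
  ; _≼_ = CRel M
  ; isPartialOrder = CRel-isPartialOrder M }

-- For every matched pair (a , b) there is a linear extension that is "X below Y"
-- except that y b sits just below x a; it reverses exactly that one pair.  Ordering
-- X and Y inside two of these extensions in mutually reverse ways separates the
-- incomparable x's and y's, so max{2, g} extensions suffice (padding with an
-- extension without pivot when g < 2).  Conversely the matched pairs form a
-- standard example: no extension reverses two of them, so at least g extensions
-- are needed, and two incomparable x's need two.

module Submission where

open import Defs
open import Data.Nat using (ℕ; zero; suc; _≤_; _<_; _⊓_; _⊔_; _+_; _∸_; z≤n; s≤s; z<s)
open import Data.Nat.Properties
open import Data.Fin using (Fin; toℕ; fromℕ<) renaming (zero to fzero; suc to fsuc)
open import Data.Fin.Properties as Fin using (toℕ-fromℕ<; toℕ<n; toℕ-injective; injective⇒≤)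
open import Data.Maybe using (Maybe; just; nothing)
open import Data.Maybe.Properties using (just-injective)
import Data.Maybe.Properties as Maybe
import Data.Product.Properties as Product
open import Data.Product using (∃; _×_; _,_; proj₁; proj₂)
open import Data.Sum using (_⊎_; inj₁; inj₂)
open import Data.List using (List; []; _∷_; length; map)
open import Data.List.Membership.Propositional using (_∈_)
open import Data.List.Relation.Unary.Any using (here; there)
open import Data.List.Relation.Unary.All using (All; _∷_)
open import Data.List.Relation.Unary.AllPairs using (_∷_)
open import Data.List.Relation.Unary.Unique.Propositional using (Unique)
open import Data.Empty using (⊥-elim)
open import Function.Definitions using (Injective)
open import Relation.Binary.PropositionalEquality
  using (_≡_; _≢_; refl; sym; trans; cong; subst; isEquivalence)
open import Relation.Binary.Structures using (IsPartialOrder; IsTotalOrder)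
open import Relation.Nullary using (¬_; Dec; yes; no; contradiction)
open import Relation.Nullary.Decidable using (decidable-stable)
import Relation.Nullary.Decidable as Dec
open import Relation.Unary using (Pred; Decidable)
open import Level using (0ℓ)

nth : ∀ {A : Set} → List A → ℕ → Maybe A
nth []       _       = nothing
nth (x ∷ xs) zero    = just x
nth (x ∷ xs) (suc n) = nth xs n

module _ {A : Set} where

  nth-∈ : ∀ (xs : List A) n {p} → nth xs n ≡ just p → p ∈ xs
  nth-∈ (x ∷ xs) zero    refl = here refl
  nth-∈ (x ∷ xs) (suc n) eq   = there (nth-∈ xs n eq)

  ∈⇒nth : ∀ {xs : List A} {p} → p ∈ xs → ∃ λ n → n < length xs × nth xs n ≡ just p
  ∈⇒nth (here refl) = 0 , s≤s z≤n , refl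
  ∈⇒nth (there p∈xs) with n , n<len , eq ← ∈⇒nth p∈xs = suc n , s≤s n<len , eq

  nth-< : ∀ (xs : List A) n → n < length xs → ∃ λ p → nth xs n ≡ just p
  nth-< (x ∷ xs) zero    _           = x , refl
  nth-< (x ∷ xs) (suc n) (s≤s n<len) = nth-< xs n n<len

  module _ {B : Set} (f : A → B) where

    nth-All-map : ∀ {P : Pred B 0ℓ} xs n {p} → All P (map f xs) → nth xs n ≡ just p → P (f p)
    nth-All-map (x ∷ xs) zero    (px ∷ _)   refl = px
    nth-All-map (x ∷ xs) (suc n) (_  ∷ pxs) eq   = nth-All-map xs n pxs eq

    nth-unique-map : ∀ xs → Unique (map f xs) → ∀ m n {p p'} →
                     nth xs m ≡ just p → nth xs n ≡ just p' → f p ≡ f p' → m ≡ n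
    nth-unique-map (x ∷ xs) (_ ∷ _) zero zero _ _ _ = refl
    nth-unique-map (x ∷ xs) (x∉ ∷ _) zero (suc n) refl eq fx≡ =
      contradiction fx≡ (nth-All-map xs n x∉ eq)
    nth-unique-map (x ∷ xs) (x∉ ∷ _) (suc m) zero eq refl fx≡ =
      contradiction (sym fx≡) (nth-All-map xs m x∉ eq)
    nth-unique-map (x ∷ xs) (_ ∷ u) (suc m) (suc n) eq eq' fx≡ =
      cong suc (nth-unique-map xs u m n eq eq' fx≡)

module _ {P : Poset} where
  open Poset P

  ≼-refl : ∀ {x} → x ≼ x
  ≼-refl = IsPartialOrder.refl isPartialOrder

  _≤[_]_ : Carrier → LinearExtension P → Carrier → Set
  x ≤[ L ] y = LinearExtension._≤L_ L x y

  rankExtension : (r : Carrier → ℕ) → Injective _≡_ _≡_ r →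
                  (∀ {x y} → x ≼ y → r x ≤ r y) → LinearExtension P
  rankExtension r r-injective r-monotone = record
    { _≤L_         = λ x y → r x ≤ r y
    ; isTotalOrder = record
      { isPartialOrder = record
        { isPreorder = record
          { isEquivalence = isEquivalence
          ; reflexive     = λ { refl → ≤-refl }
          ; trans         = ≤-trans
          }
        ; antisym = λ x≤y y≤x → r-injective (≤-antisym x≤y y≤x)
        }
      ; total = λ x y → ≤-total (r x) (r y)
      }
    ; extends = λ _ _ → r-monotone
    }

  all-or-reversed : ∀ {d} (L : Fin d → LinearExtension P) x y →
                    (∀ t → x ≤[ L t ] y) ⊎ ∃ λ t → y ≤[ L t ] x
  all-or-reversed {zero}  L x y = inj₁ λ ()
  all-or-reversed {suc d} L x y
    with IsTotalOrder.total (LinearExtension.isTotalOrder (L fzero)) x y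
  ... | inj₂ y≤x = inj₂ (fzero , y≤x)
  ... | inj₁ x≤y with all-or-reversed (λ t → L (fsuc t)) x y
  ...   | inj₁ all≤   = inj₁ λ { fzero → x≤y ; (fsuc t) → all≤ t }
  ...   | inj₂ (t , r) = inj₂ (fsuc t , r)

  reversing-extension : ∀ {d} ((L , realizes) : Realizer P d) {x y} → ¬ x ≼ y →
                        ∃ λ t → y ≤[ L t ] x
  reversing-extension (L , realizes) {x} {y} x⋠y with all-or-reversed L x y
  ... | inj₁ all≤   = contradiction (realizes x y all≤) x⋠y
  ... | inj₂ y≤ₜx = y≤ₜx

  -- Each pair (x s, y s) needs its own reversing extension: two of them in one
  -- extension L would give the cycle x s ≤ y t ≤ x t ≤ y s ≤ x s in L.
  standardExample-size≤ : ∀ {n d} → Realizer P d → (x y : Fin n → Carrier) →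
                          (∀ s → ¬ x s ≼ y s) → (∀ {s t} → s ≢ t → x s ≼ y t) → n ≤ d
  standardExample-size≤ {n} {d} R@(L , _) x y x⋠y x≼y = injective⇒≤ σ-injective
    where
    σ : Fin n → Fin d
    σ s = proj₁ (reversing-extension R (x⋠y s))

    σ-injective : Injective _≡_ _≡_ σ
    σ-injective {s} {t} σs≡σt with s Fin.≟ t
    ... | yes s≡t = s≡t
    ... | no  s≢t = ⊥-elim (x⋠y s (subst (x s ≼_) xs≡ys ≼-refl))
      where
      module L = IsTotalOrder (LinearExtension.isTotalOrder (L (σ s)))
      ext = LinearExtension.extends (L (σ s))
      ys≤xs = proj₂ (reversing-extension R (x⋠y s))
      yt≤xt = subst (λ u → y t ≤[ L u ] x t) (sym σs≡σt)
                    (proj₂ (reversing-extension R (x⋠y t)))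
      xs≤ys = L.trans (ext _ _ (x≼y s≢t))
                (L.trans yt≤xt (ext _ _ (x≼y (λ t≡s → s≢t (sym t≡s)))))
      xs≡ys = L.antisym xs≤ys ys≤xs

  incomparable-size≥2 : ∀ {d x y} → Realizer P d → ¬ x ≼ y → ¬ y ≼ x → 2 ≤ d
  incomparable-size≥2 {x = x} {y} R x⋠y y⋠x =
    standardExample-size≤ R (λ { fzero → x ; (fsuc _) → y }) (λ { fzero → y ; (fsuc _) → x })
      (λ { fzero → x⋠y ; (fsuc fzero) → y⋠x })
      (λ { {fzero} {fzero} 0≢0 → contradiction refl 0≢0
         ; {fzero} {fsuc fzero} _ → ≼-refl
         ; {fsuc fzero} {fzero} _ → ≼-refl
         ; {fsuc fzero} {fsuc fzero} 1≢1 → contradiction refl 1≢1 })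

module ExtremeKey {n : ℕ} {T B : Pred (Fin n) 0ℓ} (T? : Decidable T) (B? : Decidable B) where

  key : Fin n → ℕ
  key i with T? i | B? i
  ... | yes _ | _     = suc n
  ... | no _  | yes _ = 0
  ... | no _  | no _  = suc (toℕ i)

  key≤ : ∀ i → key i ≤ suc n
  key≤ i with T? i | B? i
  ... | yes _ | _     = ≤-refl
  ... | no _  | yes _ = z≤n
  ... | no _  | no _  = s≤s (<⇒≤ (toℕ<n i))

  key-top : ∀ {i} → T i → key i ≡ suc n
  key-top {i} Ti with T? i
  ... | yes _  = refl
  ... | no ¬Ti = contradiction Ti ¬Ti

  key-bottom : ∀ {i} → ¬ T i → B i → key i ≡ 0
  key-bottom {i} ¬Ti Bi with T? i | B? i
  ... | yes Ti | _      = contradiction Ti ¬Ti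
  ... | no _   | yes _  = refl
  ... | no _   | no ¬Bi = contradiction Bi ¬Bi

  key-injective : (∀ {i i'} → T i → T i' → i ≡ i') → (∀ {i i'} → B i → B i' → i ≡ i') →
                  Injective _≡_ _≡_ key
  key-injective T-unique B-unique {i} {i'} eq with T? i | B? i | T? i' | B? i'
  ... | yes Ti | _     | yes Ti' | _      = T-unique Ti Ti'
  ... | no _   | yes Bi | no _   | yes Bi' = B-unique Bi Bi'
  ... | no _   | no _  | no _    | no _   = toℕ-injective (suc-injective eq)
  ... | yes _  | _     | no _    | no _   = contradiction (suc-injective (sym eq)) (<⇒≢ (toℕ<n i'))
  ... | no _   | no _  | yes _   | _      = contradiction (suc-injective eq) (<⇒≢ (toℕ<n i))
  ... | yes _  | _     | no _    | yes _  with () ← eq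
  ... | no _   | yes _ | yes _   | _      with () ← eq
  ... | no _   | yes _ | no _    | no _   with () ← eq
  ... | no _   | no _  | no _    | yes _  with () ← eq

module _ {h k : ℕ} where

  IsPivotX : Maybe (Fin h × Fin k) → Pred (Fin h) 0ℓ
  IsPivotX q i = ∃ λ b → q ≡ just (i , b)

  IsPivotY : Maybe (Fin h × Fin k) → Pred (Fin k) 0ℓ
  IsPivotY q j = ∃ λ a → q ≡ just (a , j)

  pivotX? : ∀ q → Decidable (IsPivotX q)
  pivotX? nothing        i = no λ ()
  pivotX? (just (a , b)) i = Dec.map′ (λ { refl → b , refl }) (λ { (_ , refl) → refl }) (a Fin.≟ i)

  pivotY? : ∀ q → Decidable (IsPivotY q)
  pivotY? nothing        j = no λ ()
  pivotY? (just (a , b)) j = Dec.map′ (λ { refl → a , refl }) (λ { (_ , refl) → refl }) (b Fin.≟ j)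

  pivotX-unique : ∀ {q i i'} → IsPivotX q i → IsPivotX q i' → i ≡ i'
  pivotX-unique (_ , refl) (_ , eq) = cong proj₁ (just-injective eq)

  pivotY-unique : ∀ {q j j'} → IsPivotY q j → IsPivotY q j' → j ≡ j'
  pivotY-unique (_ , refl) (_ , eq) = cong proj₂ (just-injective eq)

  pivot-pair : ∀ {q i j} → IsPivotX q i → IsPivotY q j → q ≡ just (i , j)
  pivot-pair (_ , refl) (_ , eq) with refl ← just-injective eq = refl

  _≟-pivot_ : (q q' : Maybe (Fin h × Fin k)) → Dec (q ≡ q')
  _≟-pivot_ = Maybe.≡-dec (Product.≡-dec Fin._≟_ Fin._≟_)

-- The extension with pivot (a , b) is  X ∖ {x a} < y b < x a < Y ∖ {y b},  with
-- X ∖ {x a} ordered by ρ and Y ∖ {y b} by τ; without a pivot it is  X < Y.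
module PivotRank {h k : ℕ} (q : Maybe (Fin h × Fin k)) (W : ℕ)
                 (ρ : Fin h → ℕ) (ρ<W : ∀ i → ρ i < W) (τ : Fin k → ℕ) where

  xRank : Fin h → ℕ
  xRank i with pivotX? q i
  ... | yes _ = suc W
  ... | no _  = ρ i

  yRank : Fin k → ℕ
  yRank j with pivotY? q j
  ... | yes _ = W
  ... | no _  = suc (suc W) + τ j

  rank : Fin h ⊎ Fin k → ℕ
  rank (inj₁ i) = xRank i
  rank (inj₂ j) = yRank j

  private
    ρ<1+W : ∀ i → ρ i < suc W
    ρ<1+W i = m<n⇒m<1+n (ρ<W i)

    1+W<yPlain : ∀ j → suc W < suc (suc W) + τ j
    1+W<yPlain j = s≤s (s≤s (m≤m+n W (τ j)))

  xRank<yRank : ∀ {i j} → q ≢ just (i , j) → xRank i < yRank j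
  xRank<yRank {i} {j} q≢ij with pivotX? q i | pivotY? q j
  ... | yes pi | yes pj = contradiction (pivot-pair pi pj) q≢ij
  ... | yes _  | no _   = 1+W<yPlain j
  ... | no _   | yes _  = ρ<W i
  ... | no _   | no _   = <-trans (ρ<1+W i) (1+W<yPlain j)

  yRank<xRank : ∀ {i j} → q ≡ just (i , j) → yRank j < xRank i
  yRank<xRank {i} {j} q≡ij with pivotX? q i | pivotY? q j
  ... | yes _ | yes _  = n<1+n W
  ... | no ¬pi | _     = contradiction (j , q≡ij) ¬pi
  ... | yes _ | no ¬pj = contradiction (i , q≡ij) ¬pj

  yRank≤xRank⇒pivot : ∀ {i j} → yRank j ≤ xRank i → q ≡ just (i , j)
  yRank≤xRank⇒pivot {i} {j} y≤x =
    decidable-stable (q ≟-pivot just (i , j)) λ q≢ij → <⇒≱ (xRank<yRank q≢ij) y≤x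

  xRank≢yRank : ∀ i j → xRank i ≢ yRank j
  xRank≢yRank i j with q ≟-pivot just (i , j)
  ... | yes q≡ij = λ eq → <⇒≢ (yRank<xRank q≡ij) (sym eq)
  ... | no  q≢ij = <⇒≢ (xRank<yRank q≢ij)

  xRank-injective : Injective _≡_ _≡_ ρ → Injective _≡_ _≡_ xRank
  xRank-injective ρ-injective {i} {i'} eq with pivotX? q i | pivotX? q i'
  ... | yes pi | yes pi' = pivotX-unique pi pi'
  ... | yes _  | no _    = contradiction (sym eq) (<⇒≢ (ρ<1+W i'))
  ... | no _   | yes _   = contradiction eq (<⇒≢ (ρ<1+W i))
  ... | no _   | no _    = ρ-injective eq

  yRank-injective : Injective _≡_ _≡_ τ → Injective _≡_ _≡_ yRank
  yRank-injective τ-injective {j} {j'} eq with pivotY? q j | pivotY? q j'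
  ... | yes pj | yes pj' = pivotY-unique pj pj'
  ... | yes _  | no _    = contradiction eq (<⇒≢ (<-trans (n<1+n W) (1+W<yPlain j')))
  ... | no _   | yes _   = contradiction (sym eq) (<⇒≢ (<-trans (n<1+n W) (1+W<yPlain j)))
  ... | no _   | no _    = τ-injective (+-cancelˡ-≡ (suc (suc W)) _ _ eq)

  rank-injective : Injective _≡_ _≡_ ρ → Injective _≡_ _≡_ τ → Injective _≡_ _≡_ rank
  rank-injective ρ-inj τ-inj {inj₁ i} {inj₁ i'} eq = cong inj₁ (xRank-injective ρ-inj eq)
  rank-injective ρ-inj τ-inj {inj₁ i} {inj₂ j}  eq = contradiction eq (xRank≢yRank i j)
  rank-injective ρ-inj τ-inj {inj₂ j} {inj₁ i}  eq = contradiction (sym eq) (xRank≢yRank i j)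
  rank-injective ρ-inj τ-inj {inj₂ j} {inj₂ j'} eq = cong inj₂ (yRank-injective τ-inj eq)

  xRank-reflects : (∀ {a} → IsPivotX q a → ∀ i → ρ i ≤ ρ a) →
                   ∀ {i i'} → xRank i ≤ xRank i' → ρ i ≤ ρ i'
  xRank-reflects pivot-max {i} {i'} le with pivotX? q i | pivotX? q i'
  ... | yes pi | yes pi' = ≤-reflexive (cong ρ (pivotX-unique pi pi'))
  ... | yes _  | no _    = contradiction le (<⇒≱ (ρ<1+W i'))
  ... | no _   | yes pi' = pivot-max pi' i
  ... | no _   | no _    = le

  yRank-reflects : (∀ {b} → IsPivotY q b → ∀ j → τ b ≤ τ j) →
                   ∀ {j j'} → yRank j ≤ yRank j' → τ j ≤ τ j'
  yRank-reflects pivot-min {j} {j'} le with pivotY? q j | pivotY? q j'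
  ... | yes pj | yes pj' = ≤-reflexive (cong τ (pivotY-unique pj pj'))
  ... | yes pj | no _    = pivot-min pj j'
  ... | no _   | yes _   = contradiction le (<⇒≱ (<-trans (n<1+n W) (1+W<yPlain j)))
  ... | no _   | no _    = +-cancelˡ-≤ (suc (suc W)) _ _ le

data Orientation : Set where
  ascending descending : Orientation

orientation : ℕ → Orientation
orientation (suc zero) = descending
orientation _          = ascending

module _ {g h k : ℕ} (M : Matching g h k) where
  open Matching M

  pivot : ℕ → Maybe (Fin h × Fin k)
  pivot = nth pairs

  pivot-∈ : ∀ {n p} → pivot n ≡ just p → p ∈ pairs
  pivot-∈ = nth-∈ pairs _

  pivot-fst-unique : ∀ {m n p p'} → pivot m ≡ just p → pivot n ≡ just p' →
                     proj₁ p ≡ proj₁ p' → m ≡ n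
  pivot-fst-unique = nth-unique-map proj₁ pairs uniqueFst _ _

  pivot-snd-unique : ∀ {m n p p'} → pivot m ≡ just p → pivot n ≡ just p' →
                     proj₂ p ≡ proj₂ p' → m ≡ n
  pivot-snd-unique = nth-unique-map proj₂ pairs uniqueSnd _ _

  matched-entry : ∀ (s : Fin g) → ∃ λ p → pivot (toℕ s) ≡ just p
  matched-entry s = nth-< pairs (toℕ s) (subst (toℕ s <_) (sym size) (toℕ<n s))

  matched : Fin g → Fin h × Fin k
  matched s = proj₁ (matched-entry s)

  pivot-matched : ∀ s → pivot (toℕ s) ≡ just (matched s)
  pivot-matched s = proj₂ (matched-entry s)

  matched-cross-∉ : ∀ {s t} → s ≢ t → ¬ (proj₁ (matched s) , proj₂ (matched t)) ∈ pairs
  matched-cross-∉ {s} {t} s≢t cross∈ with n , _ , pivot-n ← ∈⇒nth cross∈ =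
    s≢t (toℕ-injective (trans (sym (pivot-fst-unique pivot-n (pivot-matched s) refl))
                              (pivot-snd-unique pivot-n (pivot-matched t) refl)))

  matching-size≤ : ∀ {d} → Realizer (C-g M) d → g ≤ d
  matching-size≤ R = standardExample-size≤ R
    (λ s → inj₁ (proj₁ (matched s))) (λ s → inj₂ (proj₂ (matched s)))
    (λ { s (c-lt ∉pairs) → ∉pairs (pivot-∈ (pivot-matched s)) })
    (λ s≢t → c-lt (matched-cross-∉ s≢t))

  x-incomparable : ∀ {i i'} → i ≢ i' → ¬ CRel M (inj₁ i) (inj₁ i')
  x-incomparable i≢i' c-refl = i≢i' refl

  -- Top and bottom are chosen so that in extension 0, and in extension 1 which
  -- uses both keys reversed, each pivot already sits where the key puts it; these
  -- two extensions therefore order X, and Y, in opposite ways.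
  module XKey = ExtremeKey (pivotX? (pivot 0)) (pivotX? (pivot 1))
  module YKey = ExtremeKey (pivotY? (pivot 1)) (pivotY? (pivot 0))

  pivots-differ-x : ∀ {i} → IsPivotX (pivot 0) i → ¬ IsPivotX (pivot 1) i
  pivots-differ-x (_ , e₀) (_ , e₁) with () ← pivot-fst-unique e₀ e₁ refl

  pivots-differ-y : ∀ {j} → IsPivotY (pivot 1) j → ¬ IsPivotY (pivot 0) j
  pivots-differ-y (_ , e₁) (_ , e₀) with () ← pivot-snd-unique e₀ e₁ refl

  xOrder : Orientation → Fin h → ℕ
  xOrder ascending  i = XKey.key i
  xOrder descending i = suc h ∸ XKey.key i

  yOrder : Orientation → Fin k → ℕ
  yOrder ascending  j = YKey.key j
  yOrder descending j = suc k ∸ YKey.key j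

  xOrder<2+h : ∀ o i → xOrder o i < suc (suc h)
  xOrder<2+h ascending  i = s≤s (XKey.key≤ i)
  xOrder<2+h descending i = s≤s (m∸n≤m (suc h) (XKey.key i))

  xOrder-injective : ∀ o → Injective _≡_ _≡_ (xOrder o)
  xOrder-injective ascending              = XKey.key-injective pivotX-unique pivotX-unique
  xOrder-injective descending {i} {i'} eq =
    XKey.key-injective pivotX-unique pivotX-unique (∸-cancelˡ-≡ (XKey.key≤ i) (XKey.key≤ i') eq)

  yOrder-injective : ∀ o → Injective _≡_ _≡_ (yOrder o)
  yOrder-injective ascending              = YKey.key-injective pivotY-unique pivotY-unique
  yOrder-injective descending {j} {j'} eq =
    YKey.key-injective pivotY-unique pivotY-unique (∸-cancelˡ-≡ (YKey.key≤ j) (YKey.key≤ j') eq)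

  module Ext (n : ℕ) = PivotRank (pivot n) (suc (suc h)) (xOrder (orientation n))
                                 (xOrder<2+h (orientation n)) (yOrder (orientation n))

  extension : ℕ → LinearExtension (C-g M)
  extension n = rankExtension (Ext.rank n)
    (Ext.rank-injective n (xOrder-injective (orientation n)) (yOrder-injective (orientation n)))
    λ { c-refl → ≤-refl ; (c-lt ∉pairs) → <⇒≤ (Ext.xRank<yRank n (λ e → ∉pairs (pivot-∈ e))) }

  x-separated : ∀ {i i'} → Ext.xRank 0 i ≤ Ext.xRank 0 i' → Ext.xRank 1 i ≤ Ext.xRank 1 i' →
                i ≡ i'
  x-separated le₀ le₁ = XKey.key-injective pivotX-unique pivotX-unique
    (≤-antisym (Ext.xRank-reflects 0 top₀ le₀)
               (∸-cancelʳ-≤ (XKey.key≤ _) (Ext.xRank-reflects 1 top₁ le₁)))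
    where
    top₀ : ∀ {a} → IsPivotX (pivot 0) a → ∀ i → XKey.key i ≤ XKey.key a
    top₀ pa i rewrite XKey.key-top pa = XKey.key≤ i
    top₁ : ∀ {a} → IsPivotX (pivot 1) a → ∀ i → suc h ∸ XKey.key i ≤ suc h ∸ XKey.key a
    top₁ pa i rewrite XKey.key-bottom (λ pa₀ → pivots-differ-x pa₀ pa) pa =
      m∸n≤m (suc h) (XKey.key i)

  y-separated : ∀ {j j'} → Ext.yRank 0 j ≤ Ext.yRank 0 j' → Ext.yRank 1 j ≤ Ext.yRank 1 j' →
                j ≡ j'
  y-separated le₀ le₁ = YKey.key-injective pivotY-unique pivotY-unique
    (≤-antisym (Ext.yRank-reflects 0 bottom₀ le₀)
               (∸-cancelʳ-≤ (YKey.key≤ _) (Ext.yRank-reflects 1 bottom₁ le₁)))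
    where
    bottom₀ : ∀ {b} → IsPivotY (pivot 0) b → ∀ j → YKey.key b ≤ YKey.key j
    bottom₀ pb j rewrite YKey.key-bottom (λ pb₁ → pivots-differ-y pb₁ pb) pb = z≤n
    bottom₁ : ∀ {b} → IsPivotY (pivot 1) b → ∀ j → suc k ∸ YKey.key b ≤ suc k ∸ YKey.key j
    bottom₁ pb j rewrite YKey.key-top pb | n∸n≡0 (suc k) = z≤n

  y≰x-in-both : ∀ {i j} → Ext.yRank 0 j ≤ Ext.xRank 0 i → ¬ Ext.yRank 1 j ≤ Ext.xRank 1 i
  y≰x-in-both le₀ le₁
    with () ← pivot-fst-unique (Ext.yRank≤xRank⇒pivot 0 le₀) (Ext.yRank≤xRank⇒pivot 1 le₁) refl

  matched-reversed : ∀ {i j} → (i , j) ∈ pairs → ∃ λ n → n < g × Ext.yRank n j < Ext.xRank n i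
  matched-reversed ij∈ with n , n<len , pivot-n ← ∈⇒nth ij∈ =
    n , subst (n <_) size n<len , Ext.yRank<xRank n pivot-n

  realizes : ∀ {D} → 2 ≤ D → g ≤ D → ∀ a b →
             (∀ n → n < D → Ext.rank n a ≤ Ext.rank n b) → CRel M a b
  realizes {D} 2≤D g≤D a b le = separate a b le
    where
    0<D : 0 < D
    0<D = <-≤-trans z<s 2≤D

    separate : ∀ a b → (∀ n → n < D → Ext.rank n a ≤ Ext.rank n b) → CRel M a b
    separate (inj₁ i) (inj₁ i') le with refl ← x-separated (le 0 0<D) (le 1 2≤D) = c-refl
    separate (inj₂ j) (inj₂ j') le with refl ← y-separated (le 0 0<D) (le 1 2≤D) = c-refl
    separate (inj₂ j) (inj₁ i)  le = contradiction (le 1 2≤D) (y≰x-in-both (le 0 0<D))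
    separate (inj₁ i) (inj₂ j)  le = c-lt λ ij∈ →
      let n , n<g , y<x = matched-reversed ij∈ in <⇒≱ y<x (le n (<-≤-trans n<g g≤D))

  realizer : ∀ {D} → 2 ≤ D → g ≤ D → Realizer (C-g M) D
  realizer 2≤D g≤D = (λ t → extension (toℕ t)) , λ a b ≤everywhere →
    realizes 2≤D g≤D a b λ n n<D →
      subst (λ m → Ext.rank m a ≤ Ext.rank m b) (toℕ-fromℕ< n<D) (≤everywhere (fromℕ< n<D))

  size≥2⊔g : 2 ≤ h → ∀ {d} → Realizer (C-g M) d → 2 ⊔ g ≤ d
  size≥2⊔g (s≤s (s≤s _)) R = ⊔-lub
    (incomparable-size≥2 R (x-incomparable {fzero} {fsuc fzero} λ ())
                           (x-incomparable {fsuc fzero} {fzero} λ ()))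
    (matching-size≤ R)

lemma2 : (g h k : ℕ) → 2 ≤ h → 2 ≤ k → g ≤ h ⊓ k →
    (M : Matching g h k) → HasDimension (C-g M) (2 ⊔ g)
lemma2 g h k 2≤h _ _ M =
  realizer M (m≤m⊔n 2 g) (m≤n⊔m 2 g) , λ d d<2⊔g R → <⇒≱ d<2⊔g (size≥2⊔g M 2≤h R)
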